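{- Let $n\geq 1$ be an integer, let $S=\mathbb{K}[x_1,\dots,x_n]$ for a field $\mathbb{K}$, and let $M_n^{(1)}\subset S$ be the monomial ideal \[M_n^{(1)}=\langle x_i^{n}\ (1\le i\le n),\ x_i^{n-1}x_j^{n-1}\ (1\le i<j\le n)\rangle,\] i.e. the $1$-skeleton ideal of the complete graph $K_{n+1}$ on vertex set $\{0,1,\dots,n\}$. Then the number of standard monomials of $M_n^{(1)}$ (monomials of $S$ not divisible by any generator), and hence $\dim_{\mathbb K} S/M_n^{(1)}$, equals \[(2n-1)(n-1)^{n-1}.\]
   Context: For a simple graph $G$ on vertex set $\{0,1,\dots,n\}$ with sink $0$ and a nonempty $\sigma\subseteq[n]=\{1,\dots,n\}$, set $m_\sigma=\prod_{i\in\sigma}x_i^{\mathrm{outdeg}_\sigma(i)}$, where $\mathrm{outdeg}_\sigma(i)$ is the number of vertices of $G$ not in $\sigma$ adjacent to $i$. The $1$-skeleton ideal is $M_G^{(1)}=\langle m_\sigma:\emptyset\ne\sigma\subseteq[n],\ |\sigma|\le 2\rangle$; for $G=K_{n+1}$ this is the ideal displayed in the claim. The convention $0^0=1$ is used when $n=1$. -}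

module Defs where

open import Data.Nat using (ℕ; _≤_; _∸_; _+_)
open import Data.Fin using (Fin; toℕ; _≟_)
open import Data.Bool using (if_then_else_)
open import Data.Product using (Σ; _×_; ∃)
open import Relation.Nullary using (¬_)
open import Relation.Nullary.Decidable using (⌊_⌋)
open import Relation.Binary.PropositionalEquality using (_≡_)
import Data.Nat as ℕ

-- A monomial x^a of S = K[x_1..x_n] is its exponent vector a : Fin n → ℕ
-- (variable x_{i+1} corresponds to index i : Fin n).
Monomial : ℕ → Set
Monomial n = Fin n → ℕ

_∣ᵐ_ : ∀ {n} → Monomial n → Monomial n → Set
b ∣ᵐ a = ∀ k → b k ≤ a k

scaledUnit : ∀ {n} → ℕ → Fin n → Monomial n
scaledUnit c i k = if ⌊ k ≟ i ⌋ then c else 0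

pureGen : (n : ℕ) → Fin n → Monomial n
pureGen n i = scaledUnit n i

mixedGen : (n : ℕ) → Fin n → Fin n → Monomial n
mixedGen n i j k = scaledUnit (n ∸ 1) i k + scaledUnit (n ∸ 1) j k

Standard : (n : ℕ) → Monomial n → Set
Standard n a =
  (∀ i → ¬ (pureGen n i ∣ᵐ a)) ×
  (∀ i j → toℕ i ℕ.< toℕ j → ¬ (mixedGen n i j ∣ᵐ a))

_≗ᵐ_ : ∀ {n} → Monomial n → Monomial n → Set
a ≗ᵐ b = ∀ k → a k ≡ b k

-- "the set of standard monomials of M_n^(1) has exactly N elements":
-- an injective enumeration Fin N → standard monomials hitting every one.
HasExactlyStandard : (n N : ℕ) → Set
HasExactlyStandard n N =
  Σ (Fin N → Monomial n) λ f →
    (∀ x → Standard n (f x)) ×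
    (∀ x y → f x ≗ᵐ f y → x ≡ y) ×
    (∀ a → Standard n a → ∃ λ x → f x ≗ᵐ a)

-- Write n = m + 1. A monomial avoids every x_i^n iff all its exponents are at most m,
-- and avoids every x_i^m x_j^m iff at most one exponent equals m. Splitting on the first
-- exponent (either below m, or equal to m with all the others below m) gives the count
-- c(d + 1) = m c(d) + m^d in d variables, whose solution is c(d + 1) = m^d (m + d + 1);
-- for d + 1 = n this is (2m + 1) m^m.
module Submission where

open import Defs
open import Data.Nat using (ℕ; zero; suc; _+_; _*_; _∸_; _^_; _≤_; _<_; z≤n; s≤s)
open import Data.Nat.Properties
  using ( ≤-reflexive; ≤-trans; <⇒≤; <⇒≱; ≮⇒≥; ≰⇒>; <-irrefl; m≤n⇒m<n∨m≡n
        ; m≤m+n; m≤n+m; +-identityʳ; *-identityˡ; *-identityʳ )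
open import Data.Nat.Tactic.RingSolver using (solve-∀)
open import Data.Fin using (Fin; zero; suc; toℕ; fromℕ<; _≟_)
open import Data.Fin.Properties using (toℕ-injective; toℕ<n; toℕ-fromℕ<; <⇒≢; *↔×; +↔⊎)
open import Data.Vec.Functional using (head; tail)
open import Data.Product using (Σ; _×_; ∃; _,_; swap)
open import Data.Sum using (_⊎_; inj₁; inj₂)
open import Function.Bundles using (_↔_; Inverse; _⇔_; mk⇔; Equivalence)
open import Level using (0ℓ)
open import Relation.Nullary using (¬_; yes; no; contradiction)
open import Relation.Unary using (Pred; U; _∪_; _≐_)
open import Relation.Binary.PropositionalEquality

-- HasExactlyStandard n N is Enumeration (Fin N) (Standard n). Monomials are functions,
-- so they are identified up to pointwise equality.
Enumeration : ∀ {d} → Set → Pred (Monomial d) 0ℓ → Set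
Enumeration {d} I P =
  Σ (I → Monomial d) λ f →
    (∀ x → P (f x)) ×
    (∀ x y → f x ≗ᵐ f y → x ≡ y) ×
    (∀ a → P a → ∃ λ x → f x ≗ᵐ a)

_◂_ : ∀ {d} → Pred ℕ 0ℓ → Pred (Monomial d) 0ℓ → Pred (Monomial (suc d)) 0ℓ
(H ◂ P) v = H (head v) × P (tail v)

module _ {d : ℕ} {P : Pred (Monomial d) 0ℓ} where

  enumeration-≐ : ∀ {I Q} → P ≐ Q → Enumeration I P → Enumeration I Q
  enumeration-≐ (P⊆Q , Q⊆P) (f , fP , fI , fS) =
    f , (λ x → P⊆Q (fP x)) , fI , λ a q → fS a (Q⊆P q)

  enumeration-reindex : ∀ {I J} → J ↔ I → Enumeration I P → Enumeration J P
  enumeration-reindex e (f , fP , fI , fS) =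
    (λ x → f (to x)) , (λ x → fP (to x)) , injective , surjective
    where
    open Inverse e
    injective : ∀ x y → f (to x) ≗ᵐ f (to y) → x ≡ y
    injective x y eq = begin
      x              ≡⟨ strictlyInverseʳ x ⟨
      from (to x)    ≡⟨ cong from (fI (to x) (to y) eq) ⟩
      from (to y)    ≡⟨ strictlyInverseʳ y ⟩
      y              ∎
      where open ≡-Reasoning
    surjective : ∀ a → P a → ∃ λ x → f (to x) ≗ᵐ a
    surjective a p with fS a p
    ... | y , fy≗a = from y , λ k → trans (cong (λ z → f z k) (strictlyInverseˡ y)) (fy≗a k)

  enumeration-⊎ : ∀ {I J Q} → Enumeration I P → Enumeration J Q →
    (∀ {u v} → P u → Q v → ¬ u ≗ᵐ v) → Enumeration (I ⊎ J) (P ∪ Q)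
  enumeration-⊎ {I} {J} {Q} (f , fP , fI , fS) (g , gQ , gI , gS) disjoint =
    h , hPQ , hI , hS
    where
    h : I ⊎ J → Monomial d
    h (inj₁ x) = f x
    h (inj₂ y) = g y
    hPQ : ∀ z → (P ∪ Q) (h z)
    hPQ (inj₁ x) = inj₁ (fP x)
    hPQ (inj₂ y) = inj₂ (gQ y)
    hI : ∀ z w → h z ≗ᵐ h w → z ≡ w
    hI (inj₁ x) (inj₁ x′) eq = cong inj₁ (fI x x′ eq)
    hI (inj₂ y) (inj₂ y′) eq = cong inj₂ (gI y y′ eq)
    hI (inj₁ x) (inj₂ y)  eq = contradiction eq (disjoint (fP x) (gQ y))
    hI (inj₂ y) (inj₁ x)  eq = contradiction (λ k → sym (eq k)) (disjoint (fP x) (gQ y))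
    hS : ∀ a → (P ∪ Q) a → ∃ λ z → h z ≗ᵐ a
    hS a (inj₁ p) with fS a p
    ... | x , eq = inj₁ x , eq
    hS a (inj₂ q) with gS a q
    ... | y , eq = inj₂ y , eq

  enumeration-<◂ : ∀ {I} B → Enumeration I P → Enumeration (Fin B × I) ((_< B) ◂ P)
  enumeration-<◂ {I} B (f , fP , fI , fS) = g , gP , gI , gS
    where
    g : Fin B × I → Monomial (suc d)
    g (i , x) zero    = toℕ i
    g (i , x) (suc k) = f x k
    gP : ∀ z → ((_< B) ◂ P) (g z)
    gP (i , x) = toℕ<n i , fP x
    gI : ∀ z w → g z ≗ᵐ g w → z ≡ w
    gI (i , x) (j , y) eq =
      cong₂ _,_ (toℕ-injective (eq zero)) (fI x y (λ k → eq (suc k)))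
    gS : ∀ a → ((_< B) ◂ P) a → ∃ λ z → g z ≗ᵐ a
    gS a (a₀<B , p) with fS (tail a) p
    ... | x , eq = (fromℕ< a₀<B , x) , λ where
      zero    → toℕ-fromℕ< a₀<B
      (suc k) → eq k

  enumeration-≡◂ : ∀ {I} B → Enumeration I P → Enumeration I ((_≡ B) ◂ P)
  enumeration-≡◂ {I} B (f , fP , fI , fS) = g , (λ x → refl , fP x) , gI , gS
    where
    g : I → Monomial (suc d)
    g x zero    = B
    g x (suc k) = f x k
    gI : ∀ x y → g x ≗ᵐ g y → x ≡ y
    gI x y eq = fI x y (λ k → eq (suc k))
    gS : ∀ a → ((_≡ B) ◂ P) a → ∃ λ x → g x ≗ᵐ a
    gS a (a₀≡B , p) with fS (tail a) p
    ... | x , eq = x , λ where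
      zero    → sym a₀≡B
      (suc k) → eq k

enumeration-U : Enumeration {0} (Fin 1) U
enumeration-U = (λ _ ()) , _ , (λ where zero zero _ → refl) , λ _ _ → zero , λ ()

Below : ∀ {d} → ℕ → Pred (Monomial d) 0ℓ
Below B v = ∀ k → v k < B

Below-◂ : ∀ {d} B → (_< B) ◂ Below {d} B ≐ Below B
Below-◂ B = (λ where (v₀<B , t) zero → v₀<B ; (v₀<B , t) (suc k) → t k)
          , (λ b → b zero , λ k → b (suc k))

enumeration-Below : ∀ B d → Enumeration (Fin (B ^ d)) (Below {d} B)
enumeration-Below B zero    = enumeration-≐ ((λ _ ()) , _) enumeration-U
enumeration-Below B (suc d) =
  enumeration-reindex *↔× (enumeration-≐ (Below-◂ B) (enumeration-<◂ B (enumeration-Below B d)))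

Capped : ∀ {d} → ℕ → Pred (Monomial d) 0ℓ
Capped B a = (∀ k → a k ≤ B) × (∀ i j → toℕ i < toℕ j → ¬ (B ≤ a i × B ≤ a j))

Capped-◂ : ∀ {d} B → ((_< B) ◂ Capped {d} B) ∪ ((_≡ B) ◂ Below B) ≐ Capped B
Capped-◂ B = fromParts , toParts
  where
  fromParts : ∀ {a} → (((_< B) ◂ Capped B) ∪ ((_≡ B) ◂ Below B)) a → Capped B a
  fromParts (inj₁ (a₀<B , ≤B , atMostOne)) =
      (λ where zero → <⇒≤ a₀<B ; (suc k) → ≤B k)
    , λ where
        zero    (suc j) _         (B≤a₀ , _) → <⇒≱ a₀<B B≤a₀
        (suc i) (suc j) (s≤s i<j) caps       → atMostOne i j i<j caps
  fromParts (inj₂ (a₀≡B , <B)) =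
      (λ where zero → ≤-reflexive a₀≡B ; (suc k) → <⇒≤ (<B k))
    , λ where
        zero    (suc j) _ (_ , B≤aⱼ)   → <⇒≱ (<B j) B≤aⱼ
        (suc i) (suc j) _ (B≤aᵢ , _)   → <⇒≱ (<B i) B≤aᵢ
  toParts : ∀ {a} → Capped B a → (((_< B) ◂ Capped B) ∪ ((_≡ B) ◂ Below B)) a
  toParts (≤B , atMostOne) with m≤n⇒m<n∨m≡n (≤B zero)
  ... | inj₁ a₀<B = inj₁ (a₀<B , (λ k → ≤B (suc k))
                                , λ i j i<j → atMostOne (suc i) (suc j) (s≤s i<j))
  ... | inj₂ a₀≡B = inj₂ (a₀≡B , λ k →
          ≰⇒> λ B≤aₖ → atMostOne zero (suc k) (s≤s z≤n) (≤-reflexive (sym a₀≡B) , B≤aₖ))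

cappedCount : ℕ → ℕ → ℕ
cappedCount B zero    = 1
cappedCount B (suc d) = B * cappedCount B d + B ^ d

enumeration-Capped : ∀ B d → Enumeration (Fin (cappedCount B d)) (Capped {d} B)
enumeration-Capped B zero    = enumeration-≐ ((λ _ → (λ ()) , λ ()) , _) enumeration-U
enumeration-Capped B (suc d) =
  enumeration-≐ (Capped-◂ B) (enumeration-reindex +↔⊎ (enumeration-⊎
    (enumeration-reindex *↔× (enumeration-<◂ B (enumeration-Capped B d)))
    (enumeration-≡◂ B (enumeration-Below B d))
    λ (u₀<B , _) (v₀≡B , _) u≗v → <-irrefl (trans (u≗v zero) v₀≡B) u₀<B))

cappedCount-suc : ∀ B d → cappedCount B (suc d) ≡ B ^ d * (B + suc d)
cappedCount-suc B zero    = trans (cong (_+ 1) (*-identityʳ B)) (sym (*-identityˡ (B + 1)))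
cappedCount-suc B (suc d) = begin
  B * cappedCount B (suc d) + B * B ^ d  ≡⟨ cong (λ c → B * c + B * B ^ d) (cappedCount-suc B d) ⟩
  B * (B ^ d * (B + suc d)) + B * B ^ d  ≡⟨ semiring-identity B (B ^ d) d ⟩
  B * B ^ d * (B + suc (suc d))          ∎
  where
  open ≡-Reasoning
  semiring-identity : ∀ B X d → B * (X * (B + suc d)) + B * X ≡ B * X * (B + suc (suc d))
  semiring-identity = solve-∀

scaledUnit-diag : ∀ {n} c (i : Fin n) → scaledUnit c i i ≡ c
scaledUnit-diag c i with i ≟ i
... | yes _   = refl
... | no i≢i = contradiction refl i≢i

scaledUnit-∣ᵐ : ∀ {n} c i (a : Monomial n) → c ≤ a i → scaledUnit c i ∣ᵐ a
scaledUnit-∣ᵐ c i a c≤aᵢ k with k ≟ i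
... | yes refl = c≤aᵢ
... | no _     = z≤n

pureGen-∣ᵐ : ∀ n i (a : Monomial n) → pureGen n i ∣ᵐ a ⇔ n ≤ a i
pureGen-∣ᵐ n i a = mk⇔
  (λ x∣a → subst (_≤ a i) (scaledUnit-diag n i) (x∣a i))
  (scaledUnit-∣ᵐ n i a)

mixedGen-∣ᵐ : ∀ n {i j} (a : Monomial n) → i ≢ j →
  mixedGen n i j ∣ᵐ a ⇔ (n ∸ 1 ≤ a i × n ∸ 1 ≤ a j)
mixedGen-∣ᵐ n {i} {j} a i≢j = mk⇔
  (λ x∣a → ≤-trans (≤-reflexive (sym (scaledUnit-diag c i))) (≤-trans (m≤m+n _ _) (x∣a i))
         , ≤-trans (≤-reflexive (sym (scaledUnit-diag c j))) (≤-trans (m≤n+m _ _) (x∣a j)))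
  both
  where
  c = n ∸ 1
  both : c ≤ a i × c ≤ a j → mixedGen n i j ∣ᵐ a
  both (c≤aᵢ , c≤aⱼ) k with k ≟ i | k ≟ j
  ... | yes refl | yes refl = contradiction refl i≢j
  ... | yes refl | no _     = subst (_≤ a k) (sym (+-identityʳ c)) c≤aᵢ
  ... | no _     | yes refl = c≤aⱼ
  ... | no _     | no _     = z≤n

Standard≐Capped : ∀ m → Standard (suc m) ≐ Capped m
Standard≐Capped m = toCapped , fromCapped
  where
  toCapped : ∀ {a} → Standard (suc m) a → Capped m a
  toCapped {a} (noPure , noMixed) =
      (λ k → ≮⇒≥ λ m<aₖ → noPure k (Equivalence.from (pureGen-∣ᵐ (suc m) k a) m<aₖ))
    , λ i j i<j caps → noMixed i j i<j
        (Equivalence.from (mixedGen-∣ᵐ (suc m) a (<⇒≢ i<j)) caps)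
  fromCapped : ∀ {a} → Capped m a → Standard (suc m) a
  fromCapped {a} (≤m , atMostOne) =
      (λ i x∣a → <⇒≱ (s≤s (≤m i)) (Equivalence.to (pureGen-∣ᵐ (suc m) i a) x∣a))
    , λ i j i<j x∣a → atMostOne i j i<j
        (Equivalence.to (mixedGen-∣ᵐ (suc m) a (<⇒≢ i<j)) x∣a)

standardCount : ∀ m → cappedCount m (suc m) ≡ (2 * suc m ∸ 1) * (suc m ∸ 1) ^ (suc m ∸ 1)
standardCount m = trans (cappedCount-suc m m) (semiring-identity m (m ^ m))
  where
  -- the right-hand side is the normal form of (2 * suc m ∸ 1) * X
  semiring-identity : ∀ m X → X * (m + suc m) ≡ (m + suc (m + 0)) * X
  semiring-identity = solve-∀

theorem3p2 : (n : ℕ) → 1 ≤ n →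
    HasExactlyStandard n ((2 * n ∸ 1) * (n ∸ 1) ^ (n ∸ 1))
theorem3p2 (suc m) _ =
  subst (λ N → Enumeration (Fin N) (Standard (suc m))) (standardCount m)
    (enumeration-≐ (swap (Standard≐Capped m)) (enumeration-Capped m (suc m)))
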